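{- Let $n,m,d,k$ be positive integers with $m\mid n$, let $\mathcal{F}$ be a set of $k$-MOFS$(n;n/m)$ and let $\mathcal{F}'$ be the $d$-dilation of $\mathcal{F}$. Then $\mathcal{F}'$ is maximal (i.e. no frequency square of type $(dn;dn/m)$ is orthogonal to every square of $\mathcal{F}'$) if either (1) $d^2\not\equiv 0\pmod m$ and $\mathcal{F}$ is complete, i.e. $k=(n-1)^2/(m-1)$; or (2) $d$ and $n/m$ are both odd, and $\mathcal{F}$ satisfies a Jedwab-Popatia relation.
   Context: A frequency square of type $(n;\lambda)$ is an $n\times n$ array on symbols $N(n/\lambda)=\{0,\dots,n/\lambda-1\}$ in which each symbol occurs $\lambda$ times in each row and each column; two such squares are orthogonal if, superimposed, each ordered pair of symbols occurs $\lambda^2$ times; a set of $k$-MOFS$(n;\lambda)$ is a set of $k$ pairwise orthogonal such squares. The $d$-dilation of a set of $k$-MOFS$(n;n/m)$ is the set of $k$-MOFS$(dn;dn/m)$ obtained by replacing every entry $e$ of every square by a $d\times d$ block all of whose entries equal $e$. For an (ordered) set $\mathcal{F}=\{F_1,\dots,F_k\}$ of $k$-MOFS$(n;\lambda)$, form the $n^2\times(k+2)$ array $\mathcal{O}$ having a row $[i,j,F_1[i,j],\dots,F_k[i,j]]$ for each $i,j\in\{0,\dots,n-1\}$, and let $Y_c$ be the set of symbols occurring in column $c$ of $\mathcal{O}$ ($c=0,\dots,k+1$). A relation is a tuple $(X_0,\dots,X_{k+1})$ with $X_c\subseteq Y_c$ such that every row of $\mathcal{O}$ has an even number of columns $c$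 whose entry lies in $X_c$. A Jedwab-Popatia relation is a relation with $|X_i|=1$ for all $i\ge2$ and such that at least one of $\emptyset\subsetneq X_0\subsetneq Y_0$ and $\emptyset\subsetneq X_1\subsetneq Y_1$ holds. -}

module Defs where

open import Data.Bool using (Bool; true; false; if_then_else_; _∧_)
open import Data.Nat using (ℕ; zero; suc; _+_; _*_; _∸_; _^_; _/_; NonZero)
open import Data.Nat.Divisibility using (_∣_)
open import Data.Fin using (Fin; zero; suc; quotient; _≟_)
open import Data.Fin.Subset using (Subset; _∈_; _⊂_; ∣_∣) renaming (⊥ to ∅; ⊤ to full)
open import Data.Fin.Subset.Properties using (_∈?_)
open import Data.Product using (_×_; ∃; ∃-syntax; Σ)
open import Data.Sum using (_⊎_)
open import Relation.Nullary using (¬_)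
open import Relation.Nullary.Decidable using (⌊_⌋)
open import Relation.Binary.PropositionalEquality using (_≡_; _≢_)

sumFin : ∀ {n} → (Fin n → ℕ) → ℕ
sumFin {zero}  f = 0
sumFin {suc n} f = f zero + sumFin (λ i → f (suc i))

count : ∀ {n} → (Fin n → Bool) → ℕ
count P = sumFin (λ i → if P i then 1 else 0)

count2 : ∀ {n} → (Fin n → Fin n → Bool) → ℕ
count2 P = sumFin (λ i → count (P i))

-- An n × n array with entries in N(m) = Fin m (symbols N(n/λ), here λ = n/m).
Square : ℕ → ℕ → Set
Square n m = Fin n → Fin n → Fin m

IsFreqSquare : ∀ {n m} → ℕ → Square n m → Set
IsFreqSquare {n} {m} lam F =
  (∀ (i : Fin n) (s : Fin m) → count (λ j → ⌊ F i j ≟ s ⌋) ≡ lam) ×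
  (∀ (j : Fin n) (s : Fin m) → count (λ i → ⌊ F i j ≟ s ⌋) ≡ lam)

Orthogonal : ∀ {n m} → ℕ → Square n m → Square n m → Set
Orthogonal {n} {m} lam F G =
  ∀ (s t : Fin m) → count2 (λ i j → ⌊ F i j ≟ s ⌋ ∧ ⌊ G i j ≟ t ⌋) ≡ lam * lam

IsMOFS : ∀ {n m k} → ℕ → (Fin k → Square n m) → Set
IsMOFS {n} {m} {k} lam F =
  (∀ (a : Fin k) → IsFreqSquare lam (F a)) ×
  (∀ (a b : Fin k) → a ≢ b → Orthogonal lam (F a) (F b))

-- d-dilation: entry (x , y) of the (n*d) × (n*d) array lies in block
-- (⌊x/d⌋ , ⌊y/d⌋) and takes the value of that cell of the original square.

dilateSquare : ∀ {n m} (d : ℕ) → Square n m → Square (n * d) m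
dilateSquare {n} d F x y = F (quotient {n} d x) (quotient {n} d y)

dilate : ∀ {n m k} (d : ℕ) → (Fin k → Square n m) → (Fin k → Square (n * d) m)
dilate d F a = dilateSquare d (F a)

IsMaximal : ∀ {N m k} → ℕ → (Fin k → Square N m) → Set
IsMaximal {N} {m} {k} lam F =
  ¬ (Σ (Square N m) λ G → IsFreqSquare lam G × (∀ (a : Fin k) → Orthogonal lam G (F a)))

-- Completeness: k = (n-1)^2/(m-1), i.e. k (m-1) = (n-1)^2.
IsComplete : ℕ → ℕ → ℕ → Set
IsComplete n m k = k * (m ∸ 1) ≡ (n ∸ 1) ^ 2

-- Relations on the orthogonal array O with rows [i, j, F_1[i,j], ..., F_k[i,j]].
-- Column 0 and column 1 have symbol set Y_0 = Y_1 = Fin n (every index occurs);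
-- column a+2 has symbol set Y_{a+2} = {symbols occurring in F a}.
-- A tuple (X_0, ..., X_{k+1}) is given by X0 X1 : Subset n and Xs : Fin k → Subset m.

hits : ∀ {n m k} → (Fin k → Square n m) →
       Subset n → Subset n → (Fin k → Subset m) → Fin n → Fin n → ℕ
hits F X0 X1 Xs i j =
  (if ⌊ i ∈? X0 ⌋ then 1 else 0) + (if ⌊ j ∈? X1 ⌋ then 1 else 0)
  + count (λ a → ⌊ F a i j ∈? Xs a ⌋)

IsRelation : ∀ {n m k} → (Fin k → Square n m) →
             Subset n → Subset n → (Fin k → Subset m) → Set
IsRelation {n} {m} {k} F X0 X1 Xs =
  -- X_{a+2} ⊆ Y_{a+2}  (X_0 ⊆ Y_0 = Fin n, X_1 ⊆ Y_1 = Fin n hold automatically)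
  (∀ (a : Fin k) (s : Fin m) → s ∈ Xs a → ∃[ i ] ∃[ j ] F a i j ≡ s) ×
  (∀ (i j : Fin n) → 2 ∣ hits F X0 X1 Xs i j)

IsJPRelation : ∀ {n m k} → (Fin k → Square n m) →
               Subset n → Subset n → (Fin k → Subset m) → Set
IsJPRelation {n} {m} {k} F X0 X1 Xs =
  IsRelation F X0 X1 Xs ×
  (∀ (a : Fin k) → ∣ Xs a ∣ ≡ 1) ×
  ((∅ ⊂ X0 × X0 ⊂ full) ⊎ (∅ ⊂ X1 × X1 ⊂ full))

HasJPRelation : ∀ {n m k} → (Fin k → Square n m) → Set
HasJPRelation {n} {m} {k} F =
  ∃[ X0 ] ∃[ X1 ] ∃[ Xs ] IsJPRelation {n} {m} {k} F X0 X1 Xs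

module Submission where

-- Write n = qm and view integer functions on the n × n cells with the inner product ⟪φ , ψ⟫ = Σ φ ψ.
-- The indicators of the rows, the columns and the symbol classes of the squares of F span this space
-- exactly when F is complete, the count being 1 + 2(n - 1) + k(m - 1) = n². Instead of linear algebra
-- we use the kernel K: ⟪K i j , φ⟫ is n² φ(i, j) minus what the row, column and class sums of φ predict
-- at (i, j). Every generator is orthogonal to K i j, hence ⟪K i j , K i j⟫ = n² K i j i j, and the
-- diagonal value vanishes by completeness; so K = 0 and every function is determined by those sums.
-- For a square G orthogonal to the d-dilation, the number g of cells of a d × d block carrying a fixed
-- symbol has line sums d·qd and class sums (qd)², which forces m g = d².
--
-- A Jedwab-Popatia relation has singleton sets {σ a}, and the number of hits of every cell is even.
-- Summing the hits over the cells where F 0 takes a symbol t ≠ σ 0, respectively over the block counts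
-- of G, and using orthogonality gives q(|X₀| + |X₁|) + (k - 1)q² and dqd(|X₀| + |X₁|) + k(qd)²; with q
-- and d odd these make |X₀| + |X₁| + k - 1 and |X₀| + |X₁| + k both even. With a single symbol every
-- square is constant and a proper X₀ or X₁ already changes the parity of the hits.

open import Defs
open import Algebra.Bundles using (CommutativeSemiring)
open import Data.Bool using (Bool; true; false; if_then_else_; _∧_)
open import Data.Fin using (Fin; zero; suc; fromℕ<; punchIn; _↑ˡ_; _↑ʳ_; combine; quotient; _≟_)
open import Data.Fin.Properties using (remQuot-combine; punchInᵢ≢i)
open import Data.Nat as ℕ using (ℕ; zero; suc; NonZero; parity)
import Data.Nat.Properties as ℕ
import Data.Integer as ℤ
import Data.Integer.Properties as ℤ
open import Data.Sum using (_⊎_; inj₁; inj₂; reduce)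
open import Data.Nat.Divisibility using (_∣_; divides; _∣0; ∣m∣n⇒∣m+n; ∣m⇒∣m*n)
open import Data.Parity.Base using (0ℙ; 1ℙ; _⁻¹)
import Data.Parity.Base as ℙ
import Data.Parity.Properties as ℙ
open import Data.Product using (_×_; _,_; proj₁; proj₂; ∃-syntax)
open import Function using (_∘_)
open import Relation.Nullary using (¬_; yes; no; contradiction)
open import Relation.Nullary.Decidable using (⌊_⌋; ⌊⌋-map′; isYes≗does; dec-true; dec-false)
open import Relation.Binary.PropositionalEquality

-- Finite sums

module FinSum {c ℓ} (R : CommutativeSemiring c ℓ) where
  open CommutativeSemiring R
    using (Carrier; _≈_; _+_; _*_; 0#; 1#; +-cong; +-congˡ; +-identityˡ; +-identityʳ; +-assoc;
           *-identityˡ; zeroˡ; reflexive; semiring)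
    renaming (refl to ≈-refl; sym to ≈-sym; trans to ≈-trans; setoid to ≈-setoid)
  open import Algebra.Properties.Semiring.Sum semiring public
  open import Relation.Binary.Reasoning.Setoid ≈-setoid

  𝟙 : Bool → Carrier
  𝟙 b = if b then 1# else 0#

  𝟙-∧ : ∀ a b → 𝟙 (a ∧ b) ≈ 𝟙 a * 𝟙 b
  𝟙-∧ true  b = ≈-sym (*-identityˡ _)
  𝟙-∧ false b = ≈-sym (zeroˡ _)

  sum-↑ : ∀ m n (f : Fin (m ℕ.+ n) → Carrier) →
          sum f ≈ sum (f ∘ (_↑ˡ n)) + sum (f ∘ (m ↑ʳ_))
  sum-↑ zero    n f = ≈-sym (+-identityˡ _)
  sum-↑ (suc m) n f = ≈-trans (+-congˡ (sum-↑ m n (f ∘ suc))) (≈-sym (+-assoc _ _ _))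

  sum-combine : ∀ m n (f : Fin (m ℕ.* n) → Carrier) →
                sum f ≈ ∑[ i < m ] ∑[ j < n ] f (combine i j)
  sum-combine zero    n f = ≈-refl
  sum-combine (suc m) n f =
    ≈-trans (sum-↑ n (m ℕ.* n) f) (+-congˡ (sum-combine m n (f ∘ (n ↑ʳ_))))

  sum-δ : ∀ {n} (i : Fin n) (f : Fin n → Carrier) → ∑[ j < n ] (𝟙 ⌊ i ≟ j ⌋ * f j) ≈ f i
  sum-δ {suc n} zero f = begin
    1# * f zero + ∑[ j < n ] (0# * f (suc j)) ≈⟨ +-cong (*-identityˡ _) (sum-cong-≋ {n} (λ j → zeroˡ _)) ⟩
    f zero + sum {n} (λ _ → 0#)                 ≈⟨ +-congˡ (sum-replicate-zero n) ⟩
    f zero + 0#                                ≈⟨ +-identityʳ _ ⟩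
    f zero                                     ∎
  sum-δ {suc n} (suc i) f = begin
    0# * f zero + ∑[ j < n ] (𝟙 ⌊ suc i ≟ suc j ⌋ * f (suc j))
      ≈⟨ +-cong (zeroˡ _) (sum-cong-≋ λ j → reflexive (cong (λ b → 𝟙 b * f (suc j)) (⌊⌋-map′ _ _ (i ≟ j)))) ⟩
    0# + ∑[ j < n ] (𝟙 ⌊ i ≟ j ⌋ * f (suc j))  ≈⟨ +-identityˡ _ ⟩
    ∑[ j < n ] (𝟙 ⌊ i ≟ j ⌋ * f (suc j))       ≈⟨ sum-δ i (λ j → f (suc j)) ⟩
    f (suc i)                                 ∎

open FinSum ℕ.+-*-commutativeSemiring
module ℤΣ = FinSum ℤ.+-*-commutativeSemiring

sumFin≡sum : ∀ {n} (f : Fin n → ℕ) → sumFin f ≡ sum f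
sumFin≡sum {zero}  f = refl
sumFin≡sum {suc n} f = cong (f zero ℕ.+_) (sumFin≡sum (f ∘ suc))

count≡sum𝟙 : ∀ {n} (P : Fin n → Bool) → count P ≡ ∑[ i < n ] 𝟙 (P i)
count≡sum𝟙 P = sumFin≡sum (λ i → 𝟙 (P i))

count2-∧≡sum𝟙 : ∀ {n} (P Q : Fin n → Fin n → Bool) →
  count2 (λ i j → P i j ∧ Q i j) ≡ ∑[ i < n ] ∑[ j < n ] (𝟙 (P i j) ℕ.* 𝟙 (Q i j))
count2-∧≡sum𝟙 P Q = trans (sumFin≡sum (λ i → count (λ j → P i j ∧ Q i j)))
  (sum-cong-≗ λ i → trans (count≡sum𝟙 (λ j → P i j ∧ Q i j)) (sum-cong-≗ λ j → 𝟙-∧ (P i j) (Q i j)))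

sum≡0⇒≡0 : ∀ {n} (f : Fin n → ℕ) → sum f ≡ 0 → ∀ i → f i ≡ 0
sum≡0⇒≡0 {suc n} f eq zero    = ℕ.m+n≡0⇒m≡0 (f zero) eq
sum≡0⇒≡0 {suc n} f eq (suc i) = sum≡0⇒≡0 (f ∘ suc) (ℕ.m+n≡0⇒n≡0 (f zero) eq) i

module IntegerSums where
  open import Data.Integer using (ℤ; +_; _+_; _*_; 0ℤ; ∣_∣)
  open ℤΣ using () renaming (sum to sumℤ)

  +-sum : ∀ {n} (f : Fin n → ℕ) → + sum f ≡ sumℤ (λ i → + f i)
  +-sum {zero}  f = refl
  +-sum {suc n} f = trans (ℤ.pos-+ (f zero) (sum (f ∘ suc))) (cong (_+_ (+ f zero)) (+-sum (f ∘ suc)))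

  +-𝟙 : ∀ b → + 𝟙 b ≡ ℤΣ.𝟙 b
  +-𝟙 true  = refl
  +-𝟙 false = refl

  sumℤ-const : ∀ n c → sumℤ {n} (λ _ → c) ≡ + n * c
  sumℤ-const zero    c = sym (ℤ.*-zeroˡ c)
  sumℤ-const (suc n) c = begin
    c + sumℤ {n} (λ _ → c) ≡⟨ cong (λ x → c + x) (sumℤ-const n c) ⟩
    c + + n * c            ≡⟨ cong (λ x → x + + n * c) (sym (ℤ.*-identityˡ c)) ⟩
    + 1 * c + + n * c      ≡⟨ sym (ℤ.*-distribʳ-+ c (+ 1) (+ n)) ⟩
    + suc n * c            ∎
    where open ≡-Reasoning

  +-count : ∀ {n} (P : Fin n → Bool) → + count P ≡ sumℤ (λ i → ℤΣ.𝟙 (P i))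
  +-count P = trans (cong +_ (count≡sum𝟙 P)) (trans (+-sum (λ i → 𝟙 (P i))) (ℤΣ.sum-cong-≗ λ i → +-𝟙 (P i)))

  +-sum² : ∀ {r s} (f : Fin r → Fin s → ℕ) → + sum (λ i → sum (f i)) ≡ sumℤ (λ i → sumℤ (λ j → + f i j))
  +-sum² f = trans (+-sum (λ i → sum (f i))) (ℤΣ.sum-cong-≗ λ i → +-sum (f i))

  +-𝟙* : ∀ b x → + (𝟙 b ℕ.* x) ≡ ℤΣ.𝟙 b * + x
  +-𝟙* b x = trans (ℤ.pos-* (𝟙 b) x) (cong (_* + x) (+-𝟙 b))

  +-count2-∧ : ∀ {n} (P Q : Fin n → Fin n → Bool) →
    + count2 (λ i j → P i j ∧ Q i j) ≡ sumℤ (λ i → sumℤ (λ j → ℤΣ.𝟙 (P i j) * ℤΣ.𝟙 (Q i j)))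
  +-count2-∧ P Q = trans (cong +_ (count2-∧≡sum𝟙 P Q))
    (trans (+-sum² (λ i j → 𝟙 (P i j) ℕ.* 𝟙 (Q i j)))
           (ℤΣ.sum-cong-≗ λ i → ℤΣ.sum-cong-≗ λ j →
              trans (+-𝟙* (P i j) (𝟙 (Q i j))) (cong (ℤΣ.𝟙 (P i j) *_) (+-𝟙 (Q i j)))))

  sum-squares≡0⇒≡0 : ∀ {r s} (f : Fin r → Fin s → ℤ) →
    sumℤ (λ i → sumℤ (λ j → f i j * f i j)) ≡ 0ℤ → ∀ i j → f i j ≡ 0ℤ
  sum-squares≡0⇒≡0 {r} {s} f eq i j =
    ℤ.∣i∣≡0⇒i≡0 (reduce (ℕ.m*n≡0⇒m≡0∨n≡0 ∣ f i j ∣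
      (sum≡0⇒≡0 (g i) (sum≡0⇒≡0 (λ i → sum (g i)) sum≡0 i) j)))
    where
      g : Fin r → Fin s → ℕ
      g i j = ∣ f i j ∣ ℕ.* ∣ f i j ∣
      square≡+abs : ∀ x → x * x ≡ + (∣ x ∣ ℕ.* ∣ x ∣)
      square≡+abs (+ n)      = sym (ℤ.pos-* n n)
      square≡+abs ℤ.-[1+ n ] = refl
      sum≡0 : sum (λ i → sum (g i)) ≡ 0
      sum≡0 = ℤ.+-injective (trans (+-sum² g)
                (trans (ℤΣ.sum-cong-≗ λ i → ℤΣ.sum-cong-≗ λ j → sym (square≡+abs (f i j))) eq))

-- The kernel of a set of frequency squares

module Kernel {q m k : ℕ} (F : Fin k → Square (q ℕ.* m) m) (mofs : IsMOFS q F) where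
  open import Data.Integer using (ℤ; +_; -_; _+_; _*_; _-_; 0ℤ; 1ℤ)
  open import Data.Integer.Tactic.RingSolver using (solve-∀)
  open ℤΣ using () renaming (sum to sumℤ)
  open IntegerSums
  open ≡-Reasoning

  n : ℕ
  n = q ℕ.* m

  N : ℤ
  N = + q * + m

  CellFun : Set
  CellFun = Fin n → Fin n → ℤ

  δ : ∀ {r} → Fin r → Fin r → ℤ
  δ x y = ℤΣ.𝟙 ⌊ x ≟ y ⌋

  rowSum : CellFun → Fin n → ℤ
  rowSum φ i = sumℤ (φ i)

  colSum : CellFun → Fin n → ℤ
  colSum φ j = sumℤ (λ i → φ i j)

  total : CellFun → ℤ
  total φ = sumℤ (rowSum φ)

  ⟪_,_⟫ : CellFun → CellFun → ℤ
  ⟪ φ , ψ ⟫ = total (λ i j → φ i j * ψ i j)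

  cell : Fin n → Fin n → CellFun
  cell i j i′ j′ = δ i i′ * δ j j′

  row : Fin n → CellFun
  row i i′ _ = δ i i′

  col : Fin n → CellFun
  col j _ j′ = δ j j′

  one : CellFun
  one _ _ = 1ℤ

  cls : Fin k → Fin m → CellFun
  cls a s i j = δ (F a i j) s

  agree : Fin n → Fin n → CellFun
  agree i j i′ j′ = sumℤ (λ a → cls a (F a i j) i′ j′)

  K : Fin n → Fin n → CellFun
  K i j i′ j′ = N * N * cell i j i′ j′ + (- N * row i i′ j′ + (- N * col j i′ j′
              + (- + m * agree i j i′ j′ + (+ k + 1ℤ) * one i′ j′)))

  total-+ : ∀ φ ψ → total (λ i j → φ i j + ψ i j) ≡ total φ + total ψ
  total-+ φ ψ = trans (ℤΣ.sum-cong-≗ λ i → ℤΣ.∑-distrib-+ (φ i) (ψ i)) (ℤΣ.∑-distrib-+ (rowSum φ) (rowSum ψ))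

  total-* : ∀ c φ → total (λ i j → c * φ i j) ≡ c * total φ
  total-* c φ = trans (ℤΣ.sum-cong-≗ λ i → sym (ℤΣ.*-distribˡ-sum c (φ i))) (sym (ℤΣ.*-distribˡ-sum c (rowSum φ)))

  total-sum : ∀ {r} (φ : Fin r → CellFun) → total (λ i j → sumℤ (λ a → φ a i j)) ≡ sumℤ (λ a → total (φ a))
  total-sum φ = trans (ℤΣ.sum-cong-≗ λ i → ℤΣ.∑-comm (λ j a → φ a i j)) (ℤΣ.∑-comm (λ i a → rowSum (φ a) i))

  ⟪⟫-comm : ∀ φ ψ → ⟪ φ , ψ ⟫ ≡ ⟪ ψ , φ ⟫
  ⟪⟫-comm φ ψ = ℤΣ.sum-cong-≗ λ i → ℤΣ.sum-cong-≗ λ j → ℤ.*-comm (φ i j) (ψ i j)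

  ⟪⟫-scale : ∀ c φ ψ → ⟪ (λ i j → c * φ i j) , ψ ⟫ ≡ c * ⟪ φ , ψ ⟫
  ⟪⟫-scale c φ ψ = trans (ℤΣ.sum-cong-≗ λ i → ℤΣ.sum-cong-≗ λ j → ℤ.*-assoc c (φ i j) (ψ i j))
                         (total-* c (λ i j → φ i j * ψ i j))

  ⟪⟫-linear : ∀ c {φ χ ψ u v} → ⟪ φ , ψ ⟫ ≡ u → ⟪ χ , ψ ⟫ ≡ v →
              ⟪ (λ i j → c * φ i j + χ i j) , ψ ⟫ ≡ c * u + v
  ⟪⟫-linear c {φ} {χ} {ψ} refl refl = begin
    ⟪ (λ i j → c * φ i j + χ i j) , ψ ⟫
      ≡⟨ ℤΣ.sum-cong-≗ (λ i → ℤΣ.sum-cong-≗ λ j → ℤ.*-distribʳ-+ (ψ i j) (c * φ i j) (χ i j)) ⟩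
    total (λ i j → c * φ i j * ψ i j + χ i j * ψ i j)
      ≡⟨ total-+ (λ i j → c * φ i j * ψ i j) (λ i j → χ i j * ψ i j) ⟩
    ⟪ (λ i j → c * φ i j) , ψ ⟫ + ⟪ χ , ψ ⟫
      ≡⟨ cong (λ x → x + ⟪ χ , ψ ⟫) (⟪⟫-scale c φ ψ) ⟩
    c * ⟪ φ , ψ ⟫ + ⟪ χ , ψ ⟫ ∎

  ⟪⟫-sum : ∀ {r} (φ : Fin r → CellFun) ψ →
           ⟪ (λ i j → sumℤ (λ a → φ a i j)) , ψ ⟫ ≡ sumℤ (λ a → ⟪ φ a , ψ ⟫)
  ⟪⟫-sum φ ψ = trans (ℤΣ.sum-cong-≗ λ i → ℤΣ.sum-cong-≗ λ j → ℤΣ.*-distribʳ-sum (ψ i j) (λ a → φ a i j))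
                     (total-sum (λ a i j → φ a i j * ψ i j))

  ⟪cell⟫ : ∀ i j φ → ⟪ cell i j , φ ⟫ ≡ φ i j
  ⟪cell⟫ i j φ = begin
    total (λ i′ j′ → δ i i′ * δ j j′ * φ i′ j′)
      ≡⟨ ℤΣ.sum-cong-≗ (λ i′ → trans (ℤΣ.sum-cong-≗ λ j′ → ℤ.*-assoc (δ i i′) (δ j j′) (φ i′ j′))
                                      (sym (ℤΣ.*-distribˡ-sum (δ i i′) (λ j′ → δ j j′ * φ i′ j′)))) ⟩
    sumℤ (λ i′ → δ i i′ * sumℤ (λ j′ → δ j j′ * φ i′ j′))
      ≡⟨ ℤΣ.sum-δ i _ ⟩
    sumℤ (λ j′ → δ j j′ * φ i j′)
      ≡⟨ ℤΣ.sum-δ j (φ i) ⟩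
    φ i j ∎

  ⟪row⟫ : ∀ i φ → ⟪ row i , φ ⟫ ≡ rowSum φ i
  ⟪row⟫ i φ = trans (ℤΣ.sum-cong-≗ λ i′ → sym (ℤΣ.*-distribˡ-sum (δ i i′) (φ i′))) (ℤΣ.sum-δ i (rowSum φ))

  ⟪col⟫ : ∀ j φ → ⟪ col j , φ ⟫ ≡ colSum φ j
  ⟪col⟫ j φ = ℤΣ.sum-cong-≗ λ i′ → ℤΣ.sum-δ j (φ i′)

  ⟪one⟫ : ∀ φ → ⟪ one , φ ⟫ ≡ total φ
  ⟪one⟫ φ = ℤΣ.sum-cong-≗ λ i → ℤΣ.sum-cong-≗ λ j → ℤ.*-identityˡ (φ i j)

  classTotal : CellFun → Fin n → Fin n → ℤ
  classTotal φ i j = sumℤ (λ a → ⟪ cls a (F a i j) , φ ⟫)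

  ⟪K⟫ : ∀ i j φ → ⟪ K i j , φ ⟫ ≡ N * N * φ i j + (- N * rowSum φ i + (- N * colSum φ j
                                    + (- + m * classTotal φ i j + (+ k + 1ℤ) * total φ)))
  ⟪K⟫ i j φ =
    ⟪⟫-linear (N * N) (⟪cell⟫ i j φ) (⟪⟫-linear (- N) (⟪row⟫ i φ) (⟪⟫-linear (- N) (⟪col⟫ j φ)
      (⟪⟫-linear (- + m) (⟪⟫-sum (λ a → cls a (F a i j)) φ)
        (trans (⟪⟫-scale (+ k + 1ℤ) one φ) (cong ((+ k + 1ℤ) *_) (⟪one⟫ φ))))))

  ⟪K⟫≡ : ∀ {i j φ v r c t s} → φ i j ≡ v → rowSum φ i ≡ r → colSum φ j ≡ c → classTotal φ i j ≡ t →
         total φ ≡ s → ⟪ K i j , φ ⟫ ≡ N * N * v + (- N * r + (- N * c + (- + m * t + (+ k + 1ℤ) * s)))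
  ⟪K⟫≡ refl refl refl refl refl = ⟪K⟫ _ _ _

  δ-refl : ∀ {r} (x : Fin r) → δ x x ≡ 1ℤ
  δ-refl x with x ≟ x
  ... | yes _   = refl
  ... | no x≢x = contradiction refl x≢x

  δ-sym : ∀ {r} (x y : Fin r) → δ x y ≡ δ y x
  δ-sym x y with x ≟ y | y ≟ x
  ... | yes _ | yes _ = refl
  ... | no _  | no _  = refl
  ... | yes x≡y | no y≢x = contradiction (sym x≡y) y≢x
  ... | no x≢y | yes y≡x = contradiction (sym y≡x) x≢y

  δ-transfer : ∀ {r} (x s t : Fin r) → δ x s * δ x t ≡ δ s t * δ x t
  δ-transfer x s t with x ≟ t
  ... | yes refl = cong (_* 1ℤ) (δ-sym x s)
  ... | no _     = trans (ℤ.*-zeroʳ (δ x s)) (sym (ℤ.*-zeroʳ (δ s t)))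

  sumℤ-constₙ : ∀ c → sumℤ {n} (λ _ → c) ≡ N * c
  sumℤ-constₙ c = trans (sumℤ-const n c) (cong (_* c) (ℤ.pos-* q m))

  total-rows : ∀ {φ c} → (∀ i → rowSum φ i ≡ c) → total φ ≡ N * c
  total-rows {c = c} rows = trans (ℤΣ.sum-cong-≗ rows) (sumℤ-constₙ c)

  row-count : ∀ a s i → rowSum (cls a s) i ≡ + q
  row-count a s i = trans (sym (+-count (λ j → ⌊ F a i j ≟ s ⌋))) (cong +_ (proj₁ (proj₁ mofs a) i s))

  col-count : ∀ a s j → colSum (cls a s) j ≡ + q
  col-count a s j = trans (sym (+-count (λ i → ⌊ F a i j ≟ s ⌋))) (cong +_ (proj₂ (proj₁ mofs a) j s))

  total-cls : ∀ a s → total (cls a s) ≡ N * + q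
  total-cls a s = total-rows (row-count a s)

  ⟪cls⟫-orthogonal : ∀ {a b} → a ≢ b → ∀ s t → ⟪ cls a s , cls b t ⟫ ≡ + q * + q
  ⟪cls⟫-orthogonal {a} {b} a≢b s t =
    trans (sym (+-count2-∧ (λ i j → ⌊ F a i j ≟ s ⌋) (λ i j → ⌊ F b i j ≟ t ⌋)))
          (trans (cong +_ (proj₂ mofs a b a≢b s t)) (ℤ.pos-* q q))

  ⟪cls⟫-same : ∀ a s t → ⟪ cls a s , cls a t ⟫ ≡ δ s t * (N * + q)
  ⟪cls⟫-same a s t = begin
    total (λ i j → δ (F a i j) s * δ (F a i j) t)
      ≡⟨ ℤΣ.sum-cong-≗ (λ i → ℤΣ.sum-cong-≗ λ j → δ-transfer (F a i j) s t) ⟩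
    total (λ i j → δ s t * cls a t i j)  ≡⟨ total-* (δ s t) (cls a t) ⟩
    δ s t * total (cls a t)              ≡⟨ cong (δ s t *_) (total-cls a t) ⟩
    δ s t * (N * + q)                    ∎

  ⟪⟫-one : ∀ φ → ⟪ φ , one ⟫ ≡ total φ
  ⟪⟫-one φ = trans (⟪⟫-comm φ one) (⟪one⟫ φ)

  sum-δ₁ : ∀ (r : Fin n) → sumℤ (δ r) ≡ 1ℤ
  sum-δ₁ r = trans (ℤΣ.sum-cong-≗ λ i → sym (ℤ.*-identityʳ (δ r i))) (ℤΣ.sum-δ r (λ _ → 1ℤ))

  classTotal-const : ∀ {φ} c → (∀ a s → ⟪ cls a s , φ ⟫ ≡ c) → ∀ i j → classTotal φ i j ≡ + k * c
  classTotal-const c eq i j = trans (ℤΣ.sum-cong-≗ λ a → eq a (F a i j)) (sumℤ-const k c)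

  K⊥one : ∀ i j → ⟪ K i j , one ⟫ ≡ 0ℤ
  K⊥one i j = trans (⟪K⟫≡ refl (sumℤ-constₙ 1ℤ) (sumℤ-constₙ 1ℤ)
                          (classTotal-const _ (λ a s → trans (⟪⟫-one (cls a s)) (total-cls a s)) i j)
                          (total-rows (λ _ → sumℤ-constₙ 1ℤ)))
                    (identity (+ q) (+ m) (+ k))
    where
      identity : ∀ q m k → q * m * (q * m) * 1ℤ + (- (q * m) * (q * m * 1ℤ) + (- (q * m) * (q * m * 1ℤ)
                 + (- m * (k * (q * m * q)) + (k + 1ℤ) * (q * m * (q * m * 1ℤ))))) ≡ 0ℤ
      identity = solve-∀

  K⊥row : ∀ i j r → ⟪ K i j , row r ⟫ ≡ 0ℤ
  K⊥row i j r = trans (⟪K⟫≡ refl (sumℤ-constₙ (δ r i)) (sum-δ₁ r)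
                            (classTotal-const _ (λ a s → trans (⟪⟫-comm (cls a s) (row r))
                                                 (trans (⟪row⟫ r (cls a s)) (row-count a s r))) i j)
                            (trans (sym (⟪⟫-one (row r))) (trans (⟪row⟫ r one) (sumℤ-constₙ 1ℤ))))
                      (identity (+ q) (+ m) (+ k) (δ r i))
    where
      identity : ∀ q m k x → q * m * (q * m) * x + (- (q * m) * (q * m * x) + (- (q * m) * 1ℤ
                 + (- m * (k * q) + (k + 1ℤ) * (q * m * 1ℤ)))) ≡ 0ℤ
      identity = solve-∀

  K⊥col : ∀ i j c → ⟪ K i j , col c ⟫ ≡ 0ℤ
  K⊥col i j c = trans (⟪K⟫≡ refl (sum-δ₁ c) (sumℤ-constₙ (δ c j))
                            (classTotal-const _ (λ a s → trans (⟪⟫-comm (cls a s) (col c))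
                                                 (trans (⟪col⟫ c (cls a s)) (col-count a s c))) i j)
                            (trans (sym (⟪⟫-one (col c))) (trans (⟪col⟫ c one) (sumℤ-constₙ 1ℤ))))
                      (identity (+ q) (+ m) (+ k) (δ c j))
    where
      identity : ∀ q m k x → q * m * (q * m) * x + (- (q * m) * 1ℤ + (- (q * m) * (q * m * x)
                 + (- m * (k * q) + (k + 1ℤ) * (q * m * 1ℤ)))) ≡ 0ℤ
      identity = solve-∀

  K⊥cls : ∀ i j b s → ⟪ K i j , cls b s ⟫ ≡ 0ℤ
  K⊥cls i j b s = trans (⟪K⟫≡ refl (row-count b s i) (col-count b s j) classes (total-cls b s))
                        (identity (+ q) (+ m) (+ k) x)
    where
      x excess : ℤ
      x = cls b s i j
      excess = x * (N * + q) - + q * + q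
      class : ∀ a → ⟪ cls a (F a i j) , cls b s ⟫ ≡ + q * + q + δ b a * excess
      class a with b ≟ a
      ... | yes refl = trans (⟪cls⟫-same b (F b i j) s) (shift (+ q * + q) (x * (N * + q)))
        where
          shift : ∀ u v → v ≡ u + 1ℤ * (v - u)
          shift = solve-∀
      ... | no b≢a = trans (⟪cls⟫-orthogonal (λ a≡b → b≢a (sym a≡b)) (F a i j) s) (pad (+ q * + q) excess)
        where
          pad : ∀ u v → u ≡ u + 0ℤ * v
          pad = solve-∀
      classes : classTotal (cls b s) i j ≡ + k * (+ q * + q) + excess
      classes = begin
        classTotal (cls b s) i j
          ≡⟨ ℤΣ.sum-cong-≗ class ⟩
        sumℤ (λ a → + q * + q + δ b a * excess)
          ≡⟨ ℤΣ.∑-distrib-+ (λ _ → + q * + q) (λ a → δ b a * excess) ⟩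
        sumℤ {k} (λ _ → + q * + q) + sumℤ (λ a → δ b a * excess)
          ≡⟨ cong₂ _+_ (sumℤ-const k (+ q * + q)) (ℤΣ.sum-δ b (λ _ → excess)) ⟩
        + k * (+ q * + q) + excess ∎
      identity : ∀ q m k x → q * m * (q * m) * x + (- (q * m) * q + (- (q * m) * q
                 + (- m * (k * (q * q) + (x * (q * m * q) - q * q)) + (k + 1ℤ) * (q * m * q)))) ≡ 0ℤ
      identity = solve-∀

  module Complete .{{_ : NonZero q}} .{{_ : NonZero m}} (complete : IsComplete n m k) where

    complete-ℤ : + k * (+ m - 1ℤ) ≡ (N - 1ℤ) * (N - 1ℤ)
    complete-ℤ = begin
      + k * (+ m - 1ℤ)                   ≡⟨ cong (+ k *_) (sym (+∸1 m)) ⟩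
      + k * + (m ℕ.∸ 1)                  ≡⟨ sym (ℤ.pos-* k (m ℕ.∸ 1)) ⟩
      + (k ℕ.* (m ℕ.∸ 1))                ≡⟨ cong +_ (trans complete (cong ((n ℕ.∸ 1) ℕ.*_) (ℕ.*-identityʳ _))) ⟩
      + ((n ℕ.∸ 1) ℕ.* (n ℕ.∸ 1))        ≡⟨ ℤ.pos-* (n ℕ.∸ 1) (n ℕ.∸ 1) ⟩
      + (n ℕ.∸ 1) * + (n ℕ.∸ 1)          ≡⟨ cong₂ _*_ n∸1 n∸1 ⟩
      (N - 1ℤ) * (N - 1ℤ)                ∎
      where
        +∸1 : ∀ x .{{_ : NonZero x}} → + (x ℕ.∸ 1) ≡ + x - 1ℤ
        +∸1 x = sym (ℤ.⊖-≥ (ℕ.>-nonZero⁻¹ x))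
        n∸1 : + (n ℕ.∸ 1) ≡ N - 1ℤ
        n∸1 = trans (+∸1 n {{ℕ.m*n≢0 q m}}) (cong (_- 1ℤ) (ℤ.pos-* q m))

    K-diag : ∀ i j → K i j i j ≡ 0ℤ
    K-diag i j = begin
      K i j i j                                                        ≡⟨ K≡ (δ-refl i) (δ-refl j) agree-diag ⟩
      N * N * (1ℤ * 1ℤ) + (- N * 1ℤ + (- N * 1ℤ + (- + m * (+ k * 1ℤ) + (+ k + 1ℤ) * 1ℤ)))
                                                                       ≡⟨ identity N (+ m) (+ k) ⟩
      (N - 1ℤ) * (N - 1ℤ) - + k * (+ m - 1ℤ)                          ≡⟨ cong (λ x → (N - 1ℤ) * (N - 1ℤ) - x) complete-ℤ ⟩
      (N - 1ℤ) * (N - 1ℤ) - (N - 1ℤ) * (N - 1ℤ)                       ≡⟨ ℤ.+-inverseʳ ((N - 1ℤ) * (N - 1ℤ)) ⟩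
      0ℤ                                                               ∎
      where
        K≡ : ∀ {x y z} → δ i i ≡ x → δ j j ≡ y → agree i j i j ≡ z →
             K i j i j ≡ N * N * (x * y) + (- N * x + (- N * y + (- + m * z + (+ k + 1ℤ) * 1ℤ)))
        K≡ refl refl refl = refl
        agree-diag : agree i j i j ≡ + k * 1ℤ
        agree-diag = trans (ℤΣ.sum-cong-≗ λ a → δ-refl (F a i j)) (sumℤ-const k 1ℤ)
        identity : ∀ N m k → N * N * (1ℤ * 1ℤ) + (- N * 1ℤ + (- N * 1ℤ + (- m * (k * 1ℤ) + (k + 1ℤ) * 1ℤ)))
                             ≡ (N - 1ℤ) * (N - 1ℤ) - k * (m - 1ℤ)
        identity = solve-∀

    K-self : ∀ i j → ⟪ K i j , K i j ⟫ ≡ 0ℤ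
    K-self i j = trans (⟪K⟫≡ (K-diag i j) (rows i) (cols j)
                             (classTotal-const 0ℤ (λ a s → trans (⟪⟫-comm (cls a s) (K i j)) (K⊥cls i j a s)) i j)
                             (trans (sym (⟪one⟫ (K i j))) (trans (⟪⟫-comm one (K i j)) (K⊥one i j))))
                       (identity N (+ m) (+ k))
      where
        rows : ∀ r → rowSum (K i j) r ≡ 0ℤ
        rows r = trans (sym (⟪row⟫ r (K i j))) (trans (⟪⟫-comm (row r) (K i j)) (K⊥row i j r))
        cols : ∀ c → colSum (K i j) c ≡ 0ℤ
        cols c = trans (sym (⟪col⟫ c (K i j))) (trans (⟪⟫-comm (col c) (K i j)) (K⊥col i j c))
        identity : ∀ N m k → N * N * 0ℤ + (- N * 0ℤ + (- N * 0ℤ + (- m * (k * 0ℤ) + (k + 1ℤ) * 0ℤ))) ≡ 0ℤ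
        identity = solve-∀

    K≡0 : ∀ i j i′ j′ → K i j i′ j′ ≡ 0ℤ
    K≡0 i j = sum-squares≡0⇒≡0 (K i j) (K-self i j)

    K⊥all : ∀ i j φ → ⟪ K i j , φ ⟫ ≡ 0ℤ
    K⊥all i j φ = begin
      ⟪ K i j , φ ⟫
        ≡⟨ ℤΣ.sum-cong-≗ (λ i′ → ℤΣ.sum-cong-≗ λ j′ → cong (_* φ i′ j′) (K≡0 i j i′ j′)) ⟩
      total (λ i′ j′ → 0ℤ * φ i′ j′) ≡⟨ total-* 0ℤ φ ⟩
      0ℤ * total φ                   ≡⟨ ℤ.*-zeroˡ (total φ) ⟩
      0ℤ                             ∎

    uniform-weights⇒m*g≡d² : ∀ d (g : Fin n → Fin n → ℕ) →
      (∀ i → sum (g i) ≡ d ℕ.* (q ℕ.* d)) → (∀ j → sum (λ i → g i j) ≡ d ℕ.* (q ℕ.* d)) →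
      (∀ a s → sum (λ i → sum (λ j → 𝟙 ⌊ F a i j ≟ s ⌋ ℕ.* g i j)) ≡ (q ℕ.* d) ℕ.* (q ℕ.* d)) →
      ∀ i j → m ℕ.* g i j ≡ d ℕ.* d
    uniform-weights⇒m*g≡d² d g rows cols classes i j =
      ℤ.+-injective (trans (ℤ.pos-* m (g i j)) (trans m*G≡d*d (sym (ℤ.pos-* d d))))
      where
        G : ℤ
        G = + g i j
        D L : ℤ
        D = + d * (+ q * + d)
        L = + q * + d
        +D : ∀ {x} → x ≡ d ℕ.* (q ℕ.* d) → + x ≡ D
        +D refl = trans (ℤ.pos-* d (q ℕ.* d)) (cong (+ d *_) (ℤ.pos-* q d))
        class : ∀ a s → ⟪ cls a s , (λ i j → + g i j) ⟫ ≡ L * L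
        class a s = begin
          sumℤ (λ i → sumℤ (λ j → δ (F a i j) s * + g i j))
                                                              ≡⟨ sym (ℤΣ.sum-cong-≗ λ i → ℤΣ.sum-cong-≗ λ j →
                                                                     +-𝟙* ⌊ F a i j ≟ s ⌋ (g i j)) ⟩
          sumℤ (λ i → sumℤ (λ j → + (𝟙 ⌊ F a i j ≟ s ⌋ ℕ.* g i j)))
                                                              ≡⟨ sym (+-sum² (λ i j → 𝟙 ⌊ F a i j ≟ s ⌋ ℕ.* g i j)) ⟩
          + sum (λ i → sum (λ j → 𝟙 ⌊ F a i j ≟ s ⌋ ℕ.* g i j)) ≡⟨ cong +_ (classes a s) ⟩
          + ((q ℕ.* d) ℕ.* (q ℕ.* d))                         ≡⟨ ℤ.pos-* (q ℕ.* d) (q ℕ.* d) ⟩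
          + (q ℕ.* d) * + (q ℕ.* d)                           ≡⟨ cong₂ _*_ (ℤ.pos-* q d) (ℤ.pos-* q d) ⟩
          L * L                                               ∎
        vanishing : N * N * G + (- N * D + (- N * D + (- + m * (+ k * (L * L)) + (+ k + 1ℤ) * (N * D)))) ≡ 0ℤ
        vanishing = trans (sym (⟪K⟫≡ refl (trans (sym (+-sum (g i))) (+D (rows i)))
                                          (trans (sym (+-sum (λ i → g i j))) (+D (cols j)))
                                          (classTotal-const (L * L) class i j)
                                          (total-rows (λ i → trans (sym (+-sum (g i))) (+D (rows i))))))
                          (K⊥all i j (λ i j → + g i j))
        factor : ∀ q m k d x → q * m * (q * m) * x + (- (q * m) * (d * (q * d)) + (- (q * m) * (d * (q * d))
                 + (- m * (k * (q * d * (q * d))) + (k + 1ℤ) * (q * m * (d * (q * d))))))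
                 ≡ q * q * m * (m * x) - q * q * m * (d * d)
        factor = solve-∀
        m*G≡d*d : + m * G ≡ + d * + d
        m*G≡d*d = ℤ.*-cancelˡ-≡ (+ q * + q * + m) (+ m * G) (+ d * + d)
          {{ℤ.i*j≢0 (+ q * + q) (+ m) {{ℤ.i*j≢0 (+ q) (+ q)}}}}
          (ℤ.i-j≡0⇒i≡j _ _ (trans (sym (factor (+ q) (+ m) (+ k) (+ d) G)) vanishing))

-- Opened only from here on: the operators of ℕ and the ∣_∣ of subsets would clash with those of ℤ above.
open import Data.Nat using (_+_; _*_; _/_)
open import Data.Nat.DivMod using (m*n/n≡m)
open import Algebra.Properties.CommutativeSemigroup ℕ.*-commutativeSemigroup using (xy∙z≈xz∙y)
open import Data.Fin.Subset using (Subset; _∈_; _∉_; ∣_∣; ⁅_⁆) renaming (⊥ to ∅)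
open import Data.Fin.Subset.Properties using (_∈?_; x∈⁅x⁆; x∈⁅y⁆⇒x≡y)
open import Data.Vec using (_∷_; [])

sum-const : ∀ n c → ∑[ i < n ] c ≡ n * c
sum-const zero    c = refl
sum-const (suc n) c = cong (c +_) (sum-const n c)

∑∑-+ : ∀ {r s} (f g : Fin r → Fin s → ℕ) →
       ∑[ i < r ] ∑[ j < s ] (f i j + g i j) ≡ ∑[ i < r ] ∑[ j < s ] f i j + ∑[ i < r ] ∑[ j < s ] g i j
∑∑-+ f g = trans (sum-cong-≗ λ i → ∑-distrib-+ (f i) (g i)) (∑-distrib-+ (λ i → sum (f i)) (λ i → sum (g i)))

weighted-sum : ∀ {N ρ} (w : Fin N → Fin N → ℕ) →
  (∀ x → ∑[ y < N ] w x y ≡ ρ) → (∀ y → ∑[ x < N ] w x y ≡ ρ) →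
  ∀ (a b : Fin N → ℕ) (c : Fin N → Fin N → ℕ) →
  ∑[ x < N ] ∑[ y < N ] ((a x + b y + c x y) * w x y)
    ≡ ρ * ∑[ x < N ] a x + ρ * ∑[ y < N ] b y + ∑[ x < N ] ∑[ y < N ] (c x y * w x y)
weighted-sum {N} {ρ} w rows cols a b c = begin
  ∑[ x < N ] ∑[ y < N ] ((a x + b y + c x y) * w x y)
    ≡⟨ sum-cong-≗ (λ x → sum-cong-≗ λ y → distrib (a x) (b y) (c x y) (w x y)) ⟩
  ∑[ x < N ] ∑[ y < N ] (a x * w x y + b y * w x y + c x y * w x y)
    ≡⟨ ∑∑-+ (λ x y → a x * w x y + b y * w x y) (λ x y → c x y * w x y) ⟩
  ∑[ x < N ] ∑[ y < N ] (a x * w x y + b y * w x y) + ∑[ x < N ] ∑[ y < N ] (c x y * w x y)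
    ≡⟨ cong (_+ ∑[ x < N ] ∑[ y < N ] (c x y * w x y)) (trans (∑∑-+ (λ x y → a x * w x y) (λ x y → b y * w x y))
                                                              (cong₂ _+_ by-rows by-cols)) ⟩
  ρ * ∑[ x < N ] a x + ρ * ∑[ y < N ] b y + ∑[ x < N ] ∑[ y < N ] (c x y * w x y) ∎
  where
    open ≡-Reasoning
    distrib : ∀ u v z t → (u + v + z) * t ≡ u * t + v * t + z * t
    distrib u v z t = trans (ℕ.*-distribʳ-+ t (u + v) z) (cong (_+ z * t) (ℕ.*-distribʳ-+ t u v))
    by-rows : ∑[ x < N ] ∑[ y < N ] (a x * w x y) ≡ ρ * ∑[ x < N ] a x
    by-rows = begin
      ∑[ x < N ] ∑[ y < N ] (a x * w x y) ≡⟨ sum-cong-≗ (λ x → sym (*-distribˡ-sum (a x) (w x))) ⟩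
      ∑[ x < N ] (a x * ∑[ y < N ] w x y) ≡⟨ sum-cong-≗ (λ x → trans (cong (a x *_) (rows x)) (ℕ.*-comm (a x) ρ)) ⟩
      ∑[ x < N ] (ρ * a x)                ≡⟨ sym (*-distribˡ-sum ρ a) ⟩
      ρ * ∑[ x < N ] a x                  ∎
    by-cols : ∑[ x < N ] ∑[ y < N ] (b y * w x y) ≡ ρ * ∑[ y < N ] b y
    by-cols = begin
      ∑[ x < N ] ∑[ y < N ] (b y * w x y) ≡⟨ ∑-comm (λ x y → b y * w x y) ⟩
      ∑[ y < N ] ∑[ x < N ] (b y * w x y) ≡⟨ sum-cong-≗ (λ y → sym (*-distribˡ-sum (b y) (λ x → w x y))) ⟩
      ∑[ y < N ] (b y * ∑[ x < N ] w x y) ≡⟨ sum-cong-≗ (λ y → trans (cong (b y *_) (cols y)) (ℕ.*-comm (b y) ρ)) ⟩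
      ∑[ y < N ] (ρ * b y)                ≡⟨ sym (*-distribˡ-sum ρ b) ⟩
      ρ * ∑[ y < N ] b y                  ∎

-- Block counts of a dilation

blockCount : ∀ {N d m} → Square (N * d) m → Fin m → Fin N → Fin N → ℕ
blockCount {N} {d} G t I J = ∑[ u < d ] ∑[ v < d ] 𝟙 ⌊ G (combine I u) (combine J v) ≟ t ⌋

quotient-combine : ∀ {N} d (I : Fin N) (u : Fin d) → quotient {N} d (combine I u) ≡ I
quotient-combine d I u = cong proj₁ (remQuot-combine I u)

module _ {N d m L} {G : Square (N * d) m} (G-freq : IsFreqSquare L G) (t : Fin m) where
  open ≡-Reasoning

  private
    h : Fin (N * d) → Fin (N * d) → ℕ
    h x y = 𝟙 ⌊ G x y ≟ t ⌋

    h-rows : ∀ x → ∑[ y < N * d ] h x y ≡ L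
    h-rows x = trans (sym (count≡sum𝟙 (λ y → ⌊ G x y ≟ t ⌋))) (proj₁ G-freq x t)

    h-cols : ∀ y → ∑[ x < N * d ] h x y ≡ L
    h-cols y = trans (sym (count≡sum𝟙 (λ x → ⌊ G x y ≟ t ⌋))) (proj₂ G-freq y t)

  blockCount-rows : ∀ I → ∑[ J < N ] blockCount G t I J ≡ d * L
  blockCount-rows I = begin
    ∑[ J < N ] ∑[ u < d ] ∑[ v < d ] h (combine I u) (combine J v)
      ≡⟨ ∑-comm {N} {d} (λ J u → ∑[ v < d ] h (combine I u) (combine J v)) ⟩
    ∑[ u < d ] ∑[ J < N ] ∑[ v < d ] h (combine I u) (combine J v)
      ≡⟨ sum-cong-≗ (λ u → trans (sym (sum-combine N d (h (combine I u)))) (h-rows (combine I u))) ⟩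
    ∑[ u < d ] L
      ≡⟨ sum-const d L ⟩
    d * L ∎

  blockCount-cols : ∀ J → ∑[ I < N ] blockCount G t I J ≡ d * L
  blockCount-cols J = begin
    ∑[ I < N ] ∑[ u < d ] ∑[ v < d ] h (combine I u) (combine J v)
      ≡⟨ sym (sum-combine N d (λ x → ∑[ v < d ] h x (combine J v))) ⟩
    ∑[ x < N * d ] ∑[ v < d ] h x (combine J v)
      ≡⟨ ∑-comm (λ x v → h x (combine J v)) ⟩
    ∑[ v < d ] ∑[ x < N * d ] h x (combine J v)
      ≡⟨ sum-cong-≗ (λ v → h-cols (combine J v)) ⟩
    ∑[ v < d ] L
      ≡⟨ sum-const d L ⟩
    d * L ∎

  blockCount-dilation : ∀ (f : Fin N → Fin N → ℕ) →
    ∑[ x < N * d ] ∑[ y < N * d ] (h x y * f (quotient d x) (quotient d y))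
      ≡ ∑[ I < N ] ∑[ J < N ] (f I J * blockCount G t I J)
  blockCount-dilation f = begin
    ∑[ x < N * d ] ∑[ y < N * d ] (h x y * f (quotient d x) (quotient d y))
      ≡⟨ sum-combine N d (λ x → ∑[ y < N * d ] (h x y * f (quotient d x) (quotient d y))) ⟩
    ∑[ I < N ] ∑[ u < d ] ∑[ y < N * d ] (h (combine I u) y * f (quotient d (combine I u)) (quotient d y))
      ≡⟨ sum-cong-≗ (λ I → sum-cong-≗ λ u →
           trans (sum-combine N d (λ y → h (combine I u) y * f (quotient d (combine I u)) (quotient d y)))
                 (sum-cong-≗ λ J → sum-cong-≗ λ v → cong₂ (λ I′ J′ → h (combine I u) (combine J v) * f I′ J′)
                                                         (quotient-combine d I u) (quotient-combine d J v))) ⟩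
    ∑[ I < N ] ∑[ u < d ] ∑[ J < N ] ∑[ v < d ] (h (combine I u) (combine J v) * f I J)
      ≡⟨ sum-cong-≗ (λ I → ∑-comm (λ u J → ∑[ v < d ] (h (combine I u) (combine J v) * f I J))) ⟩
    ∑[ I < N ] ∑[ J < N ] ∑[ u < d ] ∑[ v < d ] (h (combine I u) (combine J v) * f I J)
      ≡⟨ sum-cong-≗ (λ I → sum-cong-≗ λ J → factor-out I J) ⟩
    ∑[ I < N ] ∑[ J < N ] (f I J * blockCount G t I J) ∎
    where
      factor-out : ∀ I J → ∑[ u < d ] ∑[ v < d ] (h (combine I u) (combine J v) * f I J) ≡ f I J * blockCount G t I J
      factor-out I J = trans (sum-cong-≗ λ u → trans (sum-cong-≗ λ v → ℕ.*-comm (h (combine I u) (combine J v)) (f I J))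
                                                      (sym (*-distribˡ-sum (f I J) (λ v → h (combine I u) (combine J v)))))
                             (sym (*-distribˡ-sum (f I J) (λ u → ∑[ v < d ] h (combine I u) (combine J v))))

dilation-orthogonal-weights : ∀ {N d m L} {G : Square (N * d) m} (G-freq : IsFreqSquare L G) {F : Square N m} →
  Orthogonal L G (dilateSquare d F) → ∀ t s →
  ∑[ I < N ] ∑[ J < N ] (𝟙 ⌊ F I J ≟ s ⌋ * blockCount G t I J) ≡ L * L
dilation-orthogonal-weights {N} {d} {G = G} G-freq {F} orth t s =
  trans (sym (blockCount-dilation G-freq t (λ I J → 𝟙 ⌊ F I J ≟ s ⌋)))
        (trans (sym (count2-∧≡sum𝟙 (λ x y → ⌊ G x y ≟ t ⌋) (λ x y → ⌊ dilateSquare d F x y ≟ s ⌋))) (orth t s))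

-- Parity

∑-even : ∀ {n} (f : Fin n → ℕ) → (∀ i → 2 ∣ f i) → 2 ∣ sum f
∑-even {zero}  f even = 2 ∣0
∑-even {suc n} f even = ∣m∣n⇒∣m+n (even zero) (∑-even (f ∘ suc) (even ∘ suc))

even⇒parity≡0ℙ : ∀ {x} → 2 ∣ x → parity x ≡ 0ℙ
even⇒parity≡0ℙ (divides q refl) = trans (ℙ.*-homo-* q 2) (ℙ.*-zeroʳ (parity q))

parity≡0ℙ⇒even : ∀ x → parity x ≡ 0ℙ → 2 ∣ x
parity≡0ℙ⇒even zero          _  = 2 ∣0
parity≡0ℙ⇒even (suc (suc x)) eq with divides q x≡q*2 ← parity≡0ℙ⇒even x eq = divides (suc q) (cong (2 +_) x≡q*2)

odd⇒parity≡1ℙ : ∀ {x} → ¬ 2 ∣ x → parity x ≡ 1ℙ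
odd⇒parity≡1ℙ {x} odd with parity x in eq
... | 0ℙ = contradiction (parity≡0ℙ⇒even x eq) odd
... | 1ℙ = refl

even⇒¬even-suc : ∀ {x} → 2 ∣ x → ¬ 2 ∣ suc x
even⇒¬even-suc {x} even even-suc
  with () ← trans (cong _⁻¹ (sym (even⇒parity≡0ℙ even-suc))) (trans (ℙ.suc-homo-⁻¹ x) (even⇒parity≡0ℙ even))

even-with-odd-weights : ∀ ρ σ a b c → parity ρ ≡ 1ℙ → parity σ ≡ 1ℙ →
  2 ∣ ρ * a + ρ * b + c * (σ * σ) → 2 ∣ a + b + c
even-with-odd-weights ρ σ a b c ρ-odd σ-odd even =
  parity≡0ℙ⇒even (a + b + c) (trans (sym same-parity) (even⇒parity≡0ℙ even))
  where
    same-parity : parity (ρ * a + ρ * b + c * (σ * σ)) ≡ parity (a + b + c)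
    same-parity
      rewrite ℙ.+-homo-+ (ρ * a + ρ * b) (c * (σ * σ)) | ℙ.+-homo-+ (ρ * a) (ρ * b)
            | ℙ.*-homo-* ρ a | ℙ.*-homo-* ρ b | ℙ.*-homo-* c (σ * σ) | ℙ.*-homo-* σ σ | ρ-odd | σ-odd
            | ℙ.*-identityʳ (parity c) | ℙ.+-homo-+ (a + b) c | ℙ.+-homo-+ a b = refl

∣p∣≡0⇒p≡∅ : ∀ {n} (p : Subset n) → ∣ p ∣ ≡ 0 → p ≡ ∅
∣p∣≡0⇒p≡∅ []          _  = refl
∣p∣≡0⇒p≡∅ (false ∷ p) eq = cong (false ∷_) (∣p∣≡0⇒p≡∅ p eq)

∣p∣≡1⇒p≡⁅x⁆ : ∀ {n} (p : Subset n) → ∣ p ∣ ≡ 1 → ∃[ x ] p ≡ ⁅ x ⁆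
∣p∣≡1⇒p≡⁅x⁆ (true  ∷ p) eq = zero , cong (true ∷_) (∣p∣≡0⇒p≡∅ p (ℕ.suc-injective eq))
∣p∣≡1⇒p≡⁅x⁆ (false ∷ p) eq with x , refl ← ∣p∣≡1⇒p≡⁅x⁆ p eq = suc x , refl

∈?⁅⁆≡≟ : ∀ {n} (s x : Fin n) → ⌊ s ∈? ⁅ x ⁆ ⌋ ≡ ⌊ s ≟ x ⌋
∈?⁅⁆≡≟ s x with s ∈? ⁅ x ⁆ | s ≟ x
... | yes _   | yes _   = refl
... | no  _   | no  _   = refl
... | yes s∈  | no  s≢x = contradiction (x∈⁅y⁆⇒x≡y x s∈) s≢x
... | no  s∉  | yes s≡x = contradiction (subst (λ y → s ∈ ⁅ y ⁆) s≡x (x∈⁅x⁆ s)) s∉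

𝟙∈ : ∀ {n} {x : Fin n} {p} → x ∈ p → 𝟙 ⌊ x ∈? p ⌋ ≡ 1
𝟙∈ {x = x} {p} x∈p = cong 𝟙 (trans (isYes≗does (x ∈? p)) (dec-true (x ∈? p) x∈p))

𝟙∉ : ∀ {n} {x : Fin n} {p} → x ∉ p → 𝟙 ⌊ x ∈? p ⌋ ≡ 0
𝟙∉ {x = x} {p} x∉p = cong 𝟙 (trans (isYes≗does (x ∈? p)) (dec-false (x ∈? p) x∉p))

complete⇒dilation-maximal : ∀ {q m k d} .{{_ : NonZero q}} .{{_ : NonZero m}} (F : Fin k → Square (q * m) m) →
  IsMOFS q F → IsComplete (q * m) m k → ¬ (m ∣ d * d) → IsMaximal (q * d) (dilate d F)
complete⇒dilation-maximal {q} {m} {k} {d} F mofs complete m∤d² (G , G-freq , G-orth) =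
  m∤d² (divides (blockCount G t cell cell) (sym (trans (ℕ.*-comm _ m) m*g≡d²)))
  where
    open Kernel.Complete F mofs complete
    t : Fin m
    t = fromℕ< (ℕ.>-nonZero⁻¹ m)
    cell : Fin (q * m)
    cell = fromℕ< (ℕ.>-nonZero⁻¹ (q * m) {{ℕ.m*n≢0 q m}})
    m*g≡d² : m * blockCount G t cell cell ≡ d * d
    m*g≡d² = uniform-weights⇒m*g≡d² d (blockCount G t) (blockCount-rows G-freq t) (blockCount-cols G-freq t)
               (λ a → dilation-orthogonal-weights {q * m} {d} {G = G} G-freq {F a} (G-orth a) t) cell cell

-- Jedwab-Popatia relations

count-on-one-symbol : ∀ {k} (Xs : Fin k → Subset 1) (f g : Fin k → Fin 1) →
  count (λ a → ⌊ f a ∈? Xs a ⌋) ≡ count (λ a → ⌊ g a ∈? Xs a ⌋)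
count-on-one-symbol Xs f g = trans (count≡sum𝟙 (λ a → ⌊ f a ∈? Xs a ⌋))
  (trans (sum-cong-≗ λ a → cong (λ s → 𝟙 ⌊ s ∈? Xs a ⌋) (Fin1-unique (f a) (g a)))
         (sym (count≡sum𝟙 (λ a → ⌊ g a ∈? Xs a ⌋))))
  where
    Fin1-unique : (u v : Fin 1) → u ≡ v
    Fin1-unique zero zero = refl

no-JP-relation-with-one-symbol : ∀ {n k} (F : Fin k → Square n 1) → ¬ HasJPRelation F
no-JP-relation-with-one-symbol F (X₀ , X₁ , Xs , (_ , even) , _ , inj₁ ((_ , x , x∈X₀ , _) , (_ , y , _ , y∉X₀))) =
  even⇒¬even-suc (even y x) (subst (2 ∣_) row-flip (even x x))
  where
    row-flip : hits F X₀ X₁ Xs x x ≡ suc (hits F X₀ X₁ Xs y x)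
    row-flip = trans (cong₂ (λ u c → u + 𝟙 ⌊ x ∈? X₁ ⌋ + c) (𝟙∈ x∈X₀)
                            (count-on-one-symbol Xs (λ a → F a x x) (λ a → F a y x)))
                     (sym (cong (λ u → suc (u + 𝟙 ⌊ x ∈? X₁ ⌋ + count (λ a → ⌊ F a y x ∈? Xs a ⌋)))
                                (𝟙∉ y∉X₀)))
no-JP-relation-with-one-symbol F (X₀ , X₁ , Xs , (_ , even) , _ , inj₂ ((_ , x , x∈X₁ , _) , (_ , y , _ , y∉X₁))) =
  even⇒¬even-suc (even x y) (subst (2 ∣_) column-flip (even x x))
  where
    column-flip : hits F X₀ X₁ Xs x x ≡ suc (hits F X₀ X₁ Xs x y)
    column-flip = begin
      hits F X₀ X₁ Xs x x
        ≡⟨ cong₂ (λ u c → 𝟙 ⌊ x ∈? X₀ ⌋ + u + c) (𝟙∈ x∈X₁)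
                 (count-on-one-symbol Xs (λ a → F a x x) (λ a → F a x y)) ⟩
      𝟙 ⌊ x ∈? X₀ ⌋ + 1 + count (λ a → ⌊ F a x y ∈? Xs a ⌋)
        ≡⟨ cong (_+ count (λ a → ⌊ F a x y ∈? Xs a ⌋)) (ℕ.+-suc (𝟙 ⌊ x ∈? X₀ ⌋) 0) ⟩
      suc (𝟙 ⌊ x ∈? X₀ ⌋ + 0 + count (λ a → ⌊ F a x y ∈? Xs a ⌋))
        ≡⟨ cong (λ u → suc (𝟙 ⌊ x ∈? X₀ ⌋ + u + count (λ a → ⌊ F a x y ∈? Xs a ⌋))) (sym (𝟙∉ y∉X₁)) ⟩
      suc (hits F X₀ X₁ Xs x y) ∎
      where open ≡-Reasoning

singleton-relation : ∀ {N m k} {F : Fin k → Square N m} {X₀ X₁ Xs} →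
  IsRelation F X₀ X₁ Xs → (∀ a → ∣ Xs a ∣ ≡ 1) →
  ∃[ σ ] ∀ i j → 2 ∣ 𝟙 ⌊ i ∈? X₀ ⌋ + 𝟙 ⌊ j ∈? X₁ ⌋ + ∑[ a < k ] 𝟙 ⌊ F a i j ≟ σ a ⌋
singleton-relation {m = m} {k} {F} {X₀} {X₁} {Xs} (_ , even) card = σ , λ i j → subst (2 ∣_) (hits≡ i j) (even i j)
  where
    σ : Fin k → Fin m
    σ a = proj₁ (∣p∣≡1⇒p≡⁅x⁆ (Xs a) (card a))
    member≡ : ∀ a s → ⌊ s ∈? Xs a ⌋ ≡ ⌊ s ≟ σ a ⌋
    member≡ a s = trans (cong (λ p → ⌊ s ∈? p ⌋) (proj₂ (∣p∣≡1⇒p≡⁅x⁆ (Xs a) (card a))))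
                        (∈?⁅⁆≡≟ s (σ a))
    hits≡ : ∀ i j →
            hits F X₀ X₁ Xs i j ≡ 𝟙 ⌊ i ∈? X₀ ⌋ + 𝟙 ⌊ j ∈? X₁ ⌋ + ∑[ a < k ] 𝟙 ⌊ F a i j ≟ σ a ⌋
    hits≡ i j = cong (𝟙 ⌊ i ∈? X₀ ⌋ + 𝟙 ⌊ j ∈? X₁ ⌋ +_)
      (trans (count≡sum𝟙 (λ a → ⌊ F a i j ∈? Xs a ⌋)) (sum-cong-≗ λ a → cong 𝟙 (member≡ a (F a i j))))

relation-weights-even : ∀ {N m k ρ} (F : Fin k → Square N m) (σ : Fin k → Fin m) (A B : Fin N → ℕ) →
  (∀ i j → 2 ∣ A i + B j + ∑[ a < k ] 𝟙 ⌊ F a i j ≟ σ a ⌋) →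
  (w : Fin N → Fin N → ℕ) → (∀ i → ∑[ j < N ] w i j ≡ ρ) → (∀ j → ∑[ i < N ] w i j ≡ ρ) →
  2 ∣ ρ * ∑[ i < N ] A i + ρ * ∑[ j < N ] B j + ∑[ a < k ] ∑[ i < N ] ∑[ j < N ] (𝟙 ⌊ F a i j ≟ σ a ⌋ * w i j)
relation-weights-even {N} {k = k} F σ A B even w rows cols =
  subst (2 ∣_) (trans (weighted-sum w rows cols A B C) (cong (_ +_) by-symbol))
    (∑-even _ λ i → ∑-even _ λ j → ∣m⇒∣m*n (w i j) (even i j))
  where
    C : Fin N → Fin N → ℕ
    C i j = ∑[ a < k ] 𝟙 ⌊ F a i j ≟ σ a ⌋
    by-symbol : ∑[ i < N ] ∑[ j < N ] (C i j * w i j)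
                ≡ ∑[ a < k ] ∑[ i < N ] ∑[ j < N ] (𝟙 ⌊ F a i j ≟ σ a ⌋ * w i j)
    by-symbol = trans (sum-cong-≗ λ i → trans (sum-cong-≗ λ j →
                                                  *-distribʳ-sum (w i j) (λ a → 𝟙 ⌊ F a i j ≟ σ a ⌋))
                                              (∑-comm (λ j a → 𝟙 ⌊ F a i j ≟ σ a ⌋ * w i j)))
                      (∑-comm (λ i a → ∑[ j < N ] (𝟙 ⌊ F a i j ≟ σ a ⌋ * w i j)))

𝟙≟-disjoint : ∀ {n} {s t : Fin n} → s ≢ t → ∀ x → 𝟙 ⌊ x ≟ s ⌋ * 𝟙 ⌊ x ≟ t ⌋ ≡ 0
𝟙≟-disjoint {s = s} {t} s≢t x with x ≟ s | x ≟ t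
... | no _     | _        = refl
... | yes _    | no _     = refl
... | yes refl | yes refl = contradiction refl s≢t

module _ {q m k} (F : Fin (suc k) → Square (q * m) m) (σ : Fin (suc k) → Fin m) (A B : Fin (q * m) → ℕ)
         (even : ∀ i j → 2 ∣ A i + B j + ∑[ a < suc k ] 𝟙 ⌊ F a i j ≟ σ a ⌋) (q-odd : parity q ≡ 1ℙ) where

  private
    ΣA ΣB : ℕ
    ΣA = ∑[ i < q * m ] A i
    ΣB = ∑[ j < q * m ] B j

  base-parity : IsMOFS q F → ∀ {t} → t ≢ σ zero → 2 ∣ ΣA + ΣB + k
  base-parity mofs {t} t≢σ₀ = even-with-odd-weights q q ΣA ΣB k q-odd q-odd (subst (2 ∣_) (cong (q * ΣA + q * ΣB +_) classes)
    (relation-weights-even F σ A B even (λ i j → 𝟙 ⌊ F zero i j ≟ t ⌋)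
      (λ i → trans (sym (count≡sum𝟙 (λ j → ⌊ F zero i j ≟ t ⌋))) (proj₁ (proj₁ mofs zero) i t))
      (λ j → trans (sym (count≡sum𝟙 (λ i → ⌊ F zero i j ≟ t ⌋))) (proj₂ (proj₁ mofs zero) j t))))
    where
      n : ℕ
      n = q * m
      classes : ∑[ a < suc k ] ∑[ i < n ] ∑[ j < n ] (𝟙 ⌊ F a i j ≟ σ a ⌋ * 𝟙 ⌊ F zero i j ≟ t ⌋) ≡ k * (q * q)
      classes = cong₂ _+_
        (trans (sum-cong-≗ λ i → sum-cong-≗ λ j → 𝟙≟-disjoint (t≢σ₀ ∘ sym) (F zero i j))
               (trans (sum-cong-≗ {n} {λ i → ∑[ j < n ] 0} λ i → sum-replicate-zero n) (sum-replicate-zero n)))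
        (trans (sum-cong-≗ λ a → trans (sym (count2-∧≡sum𝟙 (λ i j → ⌊ F (suc a) i j ≟ σ (suc a) ⌋)
                                                             (λ i j → ⌊ F zero i j ≟ t ⌋)))
                                        (proj₂ mofs (suc a) zero (λ ()) (σ (suc a)) t))
               (sum-const k (q * q)))

  dilated-parity : ∀ {d} {G : Square (q * m * d) m} → parity d ≡ 1ℙ → IsFreqSquare (q * d) G →
    (∀ a → Orthogonal (q * d) G (dilate d F a)) → ∀ t → 2 ∣ suc (ΣA + ΣB + k)
  dilated-parity {d} {G} d-odd G-freq G-orth t =
    subst (2 ∣_) (ℕ.+-suc (ΣA + ΣB) k) (even-with-odd-weights (d * (q * d)) (q * d) ΣA ΣB (suc k) ρ-odd L-odd
      (subst (2 ∣_) (cong (d * (q * d) * ΣA + d * (q * d) * ΣB +_) classes)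
        (relation-weights-even F σ A B even (blockCount G t) (blockCount-rows G-freq t) (blockCount-cols G-freq t))))
    where
      L-odd : parity (q * d) ≡ 1ℙ
      L-odd = trans (ℙ.*-homo-* q d) (cong₂ ℙ._*_ q-odd d-odd)
      ρ-odd : parity (d * (q * d)) ≡ 1ℙ
      ρ-odd = trans (ℙ.*-homo-* d (q * d)) (cong₂ ℙ._*_ d-odd L-odd)
      classes : ∑[ a < suc k ] ∑[ i < q * m ] ∑[ j < q * m ] (𝟙 ⌊ F a i j ≟ σ a ⌋ * blockCount G t i j)
                ≡ suc k * ((q * d) * (q * d))
      classes = trans (sum-cong-≗ λ a → dilation-orthogonal-weights {q * m} {d} {G = G} G-freq {F a} (G-orth a) t (σ a))
                      (sum-const (suc k) ((q * d) * (q * d)))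

JP⇒dilation-maximal : ∀ {q m k d} .{{_ : NonZero k}} (F : Fin k → Square (q * m) m) →
  IsMOFS q F → HasJPRelation F → ¬ 2 ∣ q → ¬ 2 ∣ d → IsMaximal (q * d) (dilate d F)
JP⇒dilation-maximal {k = zero} _ _ _ _ _ = contradiction refl (ℕ.≢-nonZero⁻¹ 0)
JP⇒dilation-maximal {m = zero} {suc _} F _ (_ , _ , Xs , _ , card , _) with Xs zero | card zero
... | [] | ()
JP⇒dilation-maximal {m = suc zero} F _ JP = contradiction JP (no-JP-relation-with-one-symbol F)
JP⇒dilation-maximal {q} {suc (suc m)} {suc _} {d} F mofs (X₀ , X₁ , _ , relation , card , _) q-odd d-odd (G , G-freq , G-orth)
  with σ , even ← singleton-relation relation card =
  even⇒¬even-suc (base-parity {q} F σ A B even (odd⇒parity≡1ℙ q-odd) mofs (punchInᵢ≢i (σ zero) zero))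
                 (dilated-parity {q} F σ A B even (odd⇒parity≡1ℙ q-odd) {d} {G} (odd⇒parity≡1ℙ d-odd) G-freq G-orth (σ zero))
  where
    A B : Fin (q * suc (suc m)) → ℕ
    A i = 𝟙 ⌊ i ∈? X₀ ⌋
    B j = 𝟙 ⌊ j ∈? X₁ ⌋

q*m*d/m≡q*d : ∀ q m d .{{_ : NonZero m}} → q * m * d / m ≡ q * d
q*m*d/m≡q*d q m d = trans (cong (_/ m) (xy∙z≈xz∙y q m d)) (m*n/n≡m (q * d) m)

theorem2p5 : (n m d k : ℕ) → .{{_ : NonZero n}} → .{{_ : NonZero m}} →
    .{{_ : NonZero d}} → .{{_ : NonZero k}} → m ∣ n →
    (F : Fin k → Square n m) → IsMOFS (n / m) F →
    ((¬ (m ∣ d * d) × IsComplete n m k) ⊎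
     (¬ (2 ∣ d) × ¬ (2 ∣ n / m) × HasJPRelation F)) →
    IsMaximal ((n * d) / m) (dilate d F)
theorem2p5 n m d k (divides q refl) F mofs conditions =
  subst (λ L → IsMaximal L (dilate d F)) (sym (q*m*d/m≡q*d q m d)) (by-case conditions)
  where
    instance
      q≢0 : NonZero q
      q≢0 = ℕ.m*n≢0⇒m≢0 q
    mofs′ : IsMOFS q F
    mofs′ = subst (λ λ₀ → IsMOFS λ₀ F) (m*n/n≡m q m) mofs
    by-case : (¬ (m ∣ d * d) × IsComplete (q * m) m k) ⊎ (¬ (2 ∣ d) × ¬ (2 ∣ q * m / m) × HasJPRelation F) →
              IsMaximal (q * d) (dilate d F)
    by-case (inj₁ (m∤d² , complete)) = complete⇒dilation-maximal F mofs′ complete m∤d²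
    by-case (inj₂ (2∤d , 2∤q , JP)) = JP⇒dilation-maximal F mofs′ JP (subst (¬_ ∘ (2 ∣_)) (m*n/n≡m q m) 2∤q) 2∤d
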